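{- $(17,6)\in\mathrm{HWP}(48;3,4)$; that is, $K_{48}$ minus a 1-factor has a 2-factorization consisting of exactly $17$ $C_3$-factors and $6$ $C_4$-factors.
   Context: A $C_k$-factor of a graph is a spanning subgraph all of whose components are cycles of length $k$. A 2-factorization is a partition of the edge set into 2-factors. $\mathrm{HWP}(v;m,n)$ is the set of pairs $(\alpha,\beta)$ such that $K_v$ ($v$ odd) or $K_v$ minus a 1-factor ($v$ even) has a 2-factorization into exactly $\alpha$ $C_m$-factors and $\beta$ $C_n$-factors. -}

module Defs where

open import Data.Nat using (ℕ; _%_; _≡ᵇ_)
open import Data.Fin using (Fin)
open import Data.Fin.Properties using () renaming (_≟_ to _≟F_)
open import Data.List using (List; []; _∷_; _++_; length; filter; concat; concatMap; map; allFin)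
open import Data.Vec using (Vec; toList; zip; _∷ʳ_) renaming ([] to []ᵥ; _∷_ to _∷ᵥ_)
open import Data.Product using (_×_; _,_; Σ)
open import Data.Sum using (_⊎_)
open import Relation.Binary.PropositionalEquality using (_≡_; _≢_)
open import Relation.Nullary using (Dec; yes; no)
open import Relation.Nullary.Decidable using (_×-dec_; _⊎-dec_)
open import Data.List.Relation.Binary.Permutation.Propositional using (_↭_)
import Data.List.Membership.Propositional

-- Vertices of K_v are Fin v; an edge is recorded as an ordered pair of its endpoints.
Edge : ℕ → Set
Edge v = Fin v × Fin v

rotate : ∀ {A : Set} {k} → Vec A k → Vec A k
rotate []ᵥ = []ᵥ
rotate (x ∷ᵥ xs) = xs ∷ʳ x

cycleEdges : ∀ {v k} → Vec (Fin v) k → List (Edge v)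
cycleEdges c = toList (zip c (rotate c))

-- A C_k-factor of K_v: a collection of k-cycles whose vertex sequences together
-- list every vertex exactly once (so the cycles are vertex-disjoint, spanning,
-- and each cycle has k distinct vertices).  Only used with k ≥ 3.
IsCkFactor : (v k : ℕ) → List (Vec (Fin v) k) → Set
IsCkFactor v k cs = concatMap toList cs ↭ allFin v

factorEdges : ∀ {v k} → List (Vec (Fin v) k) → List (Edge v)
factorEdges cs = concatMap cycleEdges cs

IsOneFactor : (v : ℕ) → List (Edge v) → Set
IsOneFactor v es = concatMap (λ { (a , b) → a ∷ b ∷ [] }) es ↭ allFin v

IsRemoved : (v : ℕ) → List (Edge v) → Set
IsRemoved v R = ((v % 2 ≡ 0) × IsOneFactor v R) ⊎ ((v % 2 ≡ 1) × (R ≡ []))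

sameEdge? : ∀ {v} (x y : Fin v) (e : Edge v) → Dec ((Data.Product.proj₁ e ≡ x × Data.Product.proj₂ e ≡ y) ⊎ (Data.Product.proj₁ e ≡ y × Data.Product.proj₂ e ≡ x))
sameEdge? x y (a , b) = ((a ≟F x) ×-dec (b ≟F y)) ⊎-dec ((a ≟F y) ×-dec (b ≟F x))

occ : ∀ {v} → Fin v → Fin v → List (Edge v) → ℕ
occ x y es = length (filter (sameEdge? x y) es)

HWP : (v m n α β : ℕ) → Set
HWP v m n α β =
  Σ (List (Edge v)) λ R →
  Σ (List (List (Vec (Fin v) m))) λ Fs →
  Σ (List (List (Vec (Fin v) n))) λ Gs →
    IsRemoved v R
    × length Fs ≡ α
    × length Gs ≡ β
    × (∀ {F} → F Data.List.Membership.Propositional.∈ Fs → IsCkFactor v m F)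
    × (∀ {G} → G Data.List.Membership.Propositional.∈ Gs → IsCkFactor v n G)
    × (∀ (x y : Fin v) → x ≢ y →
         occ x y (R ++ concatMap factorEdges Fs ++ concatMap factorEdges Gs) ≡ 1)

-- Write the vertices as Z₃ × Z₁₆, with (b , x) ↦ 16 b + x, and remove the
-- 1-factor of diameters {(b , x), (b , x + 8)}.  The C₃-factors are the sixteen
-- translates under x ↦ x + 1 of one base factor together with the factor of
-- vertical triangles {(0 , x), (1 , x), (2 , x)}; between them they use every
-- edge joining two blocks and every edge of difference ±2 inside a block.  What
-- is left inside a block is the circulant graph on Z₁₆ with differences
-- ±1, ±3, ±4, ±5, ±6, ±7, and the same six C₄-factors of it are placed in all
-- three blocks.

module Submission where

open import Defs
open import Data.Nat using (ℕ; _+_; _≟_)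
open import Data.Nat.DivMod using (_mod_)
open import Data.Fin using (Fin; #_; toℕ; combine; _↑ˡ_; _↑ʳ_)
open import Data.Fin.Properties using (all?) renaming (_≟_ to _≟ᶠ_)
open import Data.List using (List; []; _∷_; _++_; [_]; _∷ʳ_; map; concatMap; filter; length; allFin; upTo)
open import Data.List.Properties using (filter-reject)
open import Data.List.Relation.Unary.All as All using ()
open import Data.List.Relation.Unary.Any using (here; there; _─_)
open import Data.List.Membership.Propositional using (_∈_)
open import Data.List.Relation.Binary.Permutation.Propositional using (_↭_; ↭-refl; ↭-sym; ↭-trans; prep; swap)
open import Data.List.Relation.Binary.Permutation.Propositional.Properties using (∈-resp-↭; ¬x∷xs↭[]; drop-∷)
open import Data.Vec as Vec using (Vec; []; _∷_; toList)
open import Data.Product using (_×_; _,_; proj₁; proj₂; uncurry)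
open import Data.Sum using (_⊎_; inj₁; inj₂)
open import Function using (_∘_)
open import Relation.Binary.Definitions using (Decidable; DecidableEquality)
open import Relation.Binary.PropositionalEquality using (_≡_; _≢_; refl; sym; trans; cong)
open import Relation.Nullary using (Dec; yes; no; ¬?)
open import Relation.Nullary.Decidable using (map′; _⊎-dec_; _→-dec_; from-yes)
open import Relation.Unary using (Pred; _⊆_) renaming (Decidable to Decidable₁)
import Data.List.Membership.DecPropositional as DecMembership

module DecPermutation {a} {A : Set a} (_≟ₐ_ : DecidableEquality A) where

  open DecMembership _≟ₐ_ using (_∈?_)

  ↭-∷─ : ∀ {x} {ys : List A} (x∈ys : x ∈ ys) → ys ↭ x ∷ (ys ─ x∈ys)
  ↭-∷─ (here refl) = ↭-refl
  ↭-∷─ {x} {y ∷ ys} (there x∈ys) = ↭-trans (prep y (↭-∷─ x∈ys)) (swap y x ↭-refl)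

  _↭?_ : Decidable (_↭_ {A = A})
  [] ↭? [] = yes ↭-refl
  [] ↭? (y ∷ ys) = no (¬x∷xs↭[] ∘ ↭-sym)
  (x ∷ xs) ↭? ys with x ∈? ys
  ... | no x∉ys = no (λ x∷xs↭ys → x∉ys (∈-resp-↭ x∷xs↭ys (here refl)))
  ... | yes x∈ys = map′ (λ xs↭ → ↭-trans (prep x xs↭) (↭-sym (↭-∷─ x∈ys)))
                        (λ x∷xs↭ys → drop-∷ (↭-trans x∷xs↭ys (↭-∷─ x∈ys)))
                        (xs ↭? (ys ─ x∈ys))

module _ {a p q} {A : Set a} {P : Pred A p} {Q : Pred A q} (P? : Decidable₁ P) (Q? : Decidable₁ Q) where

  filter-⊆-filter : P ⊆ Q → ∀ xs → filter P? (filter Q? xs) ≡ filter P? xs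
  filter-⊆-filter P⊆Q [] = refl
  filter-⊆-filter P⊆Q (x ∷ xs) with Q? x
  ... | no ¬Qx = trans (filter-⊆-filter P⊆Q xs) (sym (filter-reject P? (¬Qx ∘ P⊆Q)))
  ... | yes _ with P? x
  ...   | yes _ = cong (x ∷_) (filter-⊆-filter P⊆Q xs)
  ...   | no _ = filter-⊆-filter P⊆Q xs

module _ {v : ℕ} where

  open DecPermutation (_≟ᶠ_ {v})

  isCkFactor? : ∀ {k} (F : List (Vec (Fin v) k)) → Dec (IsCkFactor v k F)
  isCkFactor? F = concatMap toList F ↭? allFin v

  -- The vertex list is left to unification: the pattern lambda in IsOneFactor
  -- is not definitionally equal to any lambda written here.
  isOneFactor? : (M : List (Edge v)) → Dec (IsOneFactor v M)
  isOneFactor? M = _ ↭? allFin v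

  incident? : (x : Fin v) (e : Edge v) → Dec (proj₁ e ≡ x ⊎ proj₂ e ≡ x)
  incident? x (a , b) = (a ≟ᶠ x) ⊎-dec (b ≟ᶠ x)

  occ-incident : (x y : Fin v) (es : List (Edge v)) → occ x y (filter (incident? x) es) ≡ occ x y es
  occ-incident x y es = cong length (filter-⊆-filter (sameEdge? x y) (incident? x) endpoint es)
    where
    endpoint : ∀ {e : Edge v} → (proj₁ e ≡ x × proj₂ e ≡ y) ⊎ (proj₁ e ≡ y × proj₂ e ≡ x) → proj₁ e ≡ x ⊎ proj₂ e ≡ x
    endpoint (inj₁ (e₁≡x , _)) = inj₁ e₁≡x
    endpoint (inj₂ (_ , e₂≡x)) = inj₂ e₂≡x

  ExactEdgeCover : List (Edge v) → Set
  ExactEdgeCover es = ∀ x y → x ≢ y → occ x y es ≡ 1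

  coversEdgesAt? : (x : Fin v) (es : List (Edge v)) → Dec (∀ y → x ≢ y → occ x y es ≡ 1)
  coversEdgesAt? x es = all? λ y → ¬? (x ≟ᶠ y) →-dec (occ x y es ≟ 1)

  -- Counting {x, y} only among the edges at x keeps the exhaustive check fast;
  -- passing that sublist as an argument lets evaluation share it across all y.
  exactEdgeCover? : (es : List (Edge v)) → Dec (ExactEdgeCover es)
  exactEdgeCover? es =
    map′ (λ h x y x≢y → trans (sym (occ-incident x y es)) (h x y x≢y))
         (λ h x y x≢y → trans (occ-incident x y es) (h x y x≢y))
         (all? atEachVertex)
    where
    atEachVertex : ∀ x → Dec (∀ y → x ≢ y → occ x y (filter (incident? x) es) ≡ 1)
    atEachVertex x = coversEdgesAt? x (filter (incident? x) es)

Point : Set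
Point = Fin 3 × Fin 16

vertex : Point → Fin 48
vertex = uncurry combine

translate : ℕ → Point → Point
translate j (b , x) = b , (toℕ x + j) mod 16

develop : ∀ {k} → List (Vec Point k) → ℕ → List (Vec (Fin 48) k)
develop F j = map (Vec.map (vertex ∘ translate j)) F

inEveryBlock : ∀ {k} → List (Vec (Fin 16) k) → List (Vec (Fin 48) k)
inEveryBlock F = concatMap (λ b → map (Vec.map (combine b)) F) (allFin 3)

diameters : List (Edge 48)
diameters = concatMap (λ b → map (λ x → combine b (x ↑ˡ 8) , combine b (8 ↑ʳ x)) (allFin 8)) (allFin 3)

baseTriangles : List (Vec Point 3)
baseTriangles =
    ((# 0 , # 14) ∷ (# 0 , # 0) ∷ (# 1 , # 2) ∷ []) ∷
    ((# 1 , # 7) ∷ (# 1 , # 9) ∷ (# 2 , # 0) ∷ []) ∷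
    ((# 2 , # 12) ∷ (# 2 , # 14) ∷ (# 0 , # 6) ∷ []) ∷
    ((# 0 , # 1) ∷ (# 1 , # 14) ∷ (# 2 , # 15) ∷ []) ∷
    ((# 0 , # 2) ∷ (# 1 , # 1) ∷ (# 2 , # 3) ∷ []) ∷
    ((# 0 , # 3) ∷ (# 1 , # 11) ∷ (# 2 , # 5) ∷ []) ∷
    ((# 0 , # 4) ∷ (# 1 , # 5) ∷ (# 2 , # 11) ∷ []) ∷
    ((# 0 , # 5) ∷ (# 1 , # 15) ∷ (# 2 , # 10) ∷ []) ∷
    ((# 0 , # 7) ∷ (# 1 , # 12) ∷ (# 2 , # 1) ∷ []) ∷
    ((# 0 , # 8) ∷ (# 1 , # 6) ∷ (# 2 , # 4) ∷ []) ∷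
    ((# 0 , # 9) ∷ (# 1 , # 0) ∷ (# 2 , # 13) ∷ []) ∷
    ((# 0 , # 10) ∷ (# 1 , # 13) ∷ (# 2 , # 9) ∷ []) ∷
    ((# 0 , # 11) ∷ (# 1 , # 4) ∷ (# 2 , # 8) ∷ []) ∷
    ((# 0 , # 12) ∷ (# 1 , # 8) ∷ (# 2 , # 7) ∷ []) ∷
    ((# 0 , # 13) ∷ (# 1 , # 3) ∷ (# 2 , # 6) ∷ []) ∷
    ((# 0 , # 15) ∷ (# 1 , # 10) ∷ (# 2 , # 2) ∷ []) ∷
    []

vertical : Vec Point 3
vertical = (# 0 , # 0) ∷ (# 1 , # 0) ∷ (# 2 , # 0) ∷ []

triangleFactors : List (List (Vec (Fin 48) 3))
triangleFactors = map (develop baseTriangles) (upTo 16) ∷ʳ concatMap (develop [ vertical ]) (upTo 16)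

blockSquareFactors : List (List (Vec (Fin 16) 4))
blockSquareFactors =
    ((# 0 ∷ # 1 ∷ # 2 ∷ # 3 ∷ []) ∷ (# 4 ∷ # 5 ∷ # 6 ∷ # 7 ∷ []) ∷ (# 8 ∷ # 9 ∷ # 10 ∷ # 11 ∷ []) ∷ (# 12 ∷ # 13 ∷ # 14 ∷ # 15 ∷ []) ∷ []) ∷
    ((# 0 ∷ # 4 ∷ # 1 ∷ # 5 ∷ []) ∷ (# 2 ∷ # 6 ∷ # 3 ∷ # 7 ∷ []) ∷ (# 8 ∷ # 12 ∷ # 9 ∷ # 13 ∷ []) ∷ (# 10 ∷ # 14 ∷ # 11 ∷ # 15 ∷ []) ∷ []) ∷
    ((# 0 ∷ # 6 ∷ # 1 ∷ # 7 ∷ []) ∷ (# 2 ∷ # 5 ∷ # 10 ∷ # 13 ∷ []) ∷ (# 3 ∷ # 4 ∷ # 11 ∷ # 12 ∷ []) ∷ (# 8 ∷ # 14 ∷ # 9 ∷ # 15 ∷ []) ∷ []) ∷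
    ((# 0 ∷ # 9 ∷ # 2 ∷ # 11 ∷ []) ∷ (# 1 ∷ # 8 ∷ # 3 ∷ # 10 ∷ []) ∷ (# 4 ∷ # 13 ∷ # 6 ∷ # 15 ∷ []) ∷ (# 5 ∷ # 12 ∷ # 7 ∷ # 14 ∷ []) ∷ []) ∷
    ((# 0 ∷ # 10 ∷ # 6 ∷ # 12 ∷ []) ∷ (# 1 ∷ # 11 ∷ # 7 ∷ # 13 ∷ []) ∷ (# 2 ∷ # 8 ∷ # 5 ∷ # 15 ∷ []) ∷ (# 3 ∷ # 9 ∷ # 4 ∷ # 14 ∷ []) ∷ []) ∷
    ((# 0 ∷ # 13 ∷ # 3 ∷ # 15 ∷ []) ∷ (# 1 ∷ # 12 ∷ # 2 ∷ # 14 ∷ []) ∷ (# 4 ∷ # 8 ∷ # 7 ∷ # 10 ∷ []) ∷ (# 5 ∷ # 9 ∷ # 6 ∷ # 11 ∷ []) ∷ []) ∷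
    []

squareFactors : List (List (Vec (Fin 48) 4))
squareFactors = map inEveryBlock blockSquareFactors

lemma3p3 : HWP 48 3 4 17 6
lemma3p3 =
  diameters , triangleFactors , squareFactors ,
  inj₁ (refl , from-yes (isOneFactor? diameters)) , refl , refl ,
  All.lookup (from-yes (All.all? isCkFactor? triangleFactors)) ,
  All.lookup (from-yes (All.all? isCkFactor? squareFactors)) ,
  from-yes (exactEdgeCover? (diameters ++ concatMap factorEdges triangleFactors
                                       ++ concatMap factorEdges squareFactors))
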